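{- For each orthomodular lattice $X$, the set $\mathrm{End}(X)=\mathbf{OMLatGal}(X,X)$ is a Foulis semigroup with composition as multiplication, $\mathrm{id}_X$ as unit, dagger $(s_*,s^*)^\dagger=(s^*,s_*)$ as involution, and $[s]=\ker(s)\circ\ker(s)^\dagger$. Equivalently, for $s\colon X\to X$ and $x\in X$, $[s]_*(x)=[s]^*(x)=s^*(1)\supset x^\perp=s^*(1)^\perp\vee(s^*(1)\wedge x^\perp)=(x\mathbin{\&}s^*(1))^\perp$, where $a\supset b=a^\perp\vee(a\wedge b)$ and $a\mathbin{\&}b=b\wedge(b^\perp\vee a)$.
   Context: An orthomodular lattice is a bounded lattice with orthocomplement $x\mapsto x^\perp$ ($x^{\perp\perp}=x$, order-reversing, $x\wedge x^\perp=0$) with $x\le y\Rightarrow y=x\vee(x^\perp\wedge y)$. $\mathbf{OMLatGal}$: objects orthomodular lattices; morphisms $f\colon X\to Y$ pairs $(f_*,f^*)$ of order-reversing maps with $x\le f^*(y)\iff y\le f_*(x)$; identity $((-)^\perp,(-)^\perp)$; composition $(g\circ f)_*=g_*\circ(-)^\perp\circ f_*$, $(g\circ f)^*=f^*\circ(-)^\perp\circ g^*$. It is a dagger kernel category in which the kernel of $f\colon X\to Y$ is $k\colon{\downarrow}k\to X$ with $k=f^*(1)$, $k_*(u)=u^\perp$, $k^*(x)=k\wedge x^\perp$ (where ${\downarrow}k=\{u\le k\}$ with orthocomplement $u\mapsto k\wedge u^\perp$). A Foulis semigroup is a monoid $(S,\cdot,1)$ with maps $(-)^\dagger,[-]\colon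 S\to S$ such that: $1^\dagger=1$, $(st)^\dagger=t^\dagger s^\dagger$, $s^{\dagger\dagger}=s$; $[s][s]=[s]=[s]^\dagger$; $0:=[1]$ satisfies $0s=0=s0$; and $s\cdot x=0$ iff $x=[s]\cdot y$ for some $y$. -}

module Defs where

open import Level using (Level; _⊔_) renaming (suc to lsuc)
open import Data.Product using (Σ; Σ-syntax; _×_; _,_; proj₁; proj₂)
open import Relation.Binary.Lattice.Bundles using (BoundedLattice)

record OrthomodularLattice c ℓ₁ ℓ₂ : Set (lsuc (c ⊔ ℓ₁ ⊔ ℓ₂)) where
  field
    boundedLattice : BoundedLattice c ℓ₁ ℓ₂
  open BoundedLattice boundedLattice public
  infix 8 _ᗮ
  field
    _ᗮ           : Carrier → Carrier
    ᗮ-involutive : ∀ x → (x ᗮ) ᗮ ≈ x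
    ᗮ-antitone   : ∀ {x y} → x ≤ y → y ᗮ ≤ x ᗮ
    ᗮ-meet       : ∀ x → (x ∧ x ᗮ) ≈ ⊥
    orthomodular : ∀ {x y} → x ≤ y → y ≈ x ∨ (x ᗮ ∧ y)

  infixr 5 _⊃_
  infixl 6 _&_
  _⊃_ : Carrier → Carrier → Carrier
  a ⊃ b = a ᗮ ∨ (a ∧ b)

  _&_ : Carrier → Carrier → Carrier
  a & b = b ∧ (b ᗮ ∨ a)

-- The data needed to speak about OMLatGal-morphisms: a carrier with
-- equality, order and orthocomplement.  (Objects of OMLatGal are OMLs;
-- below we only use these components of them, and of the down-sets ↓k.)

record Ortho c ℓ₁ ℓ₂ : Set (lsuc (c ⊔ ℓ₁ ⊔ ℓ₂)) where
  field
    Carrier : Set c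
    _≈_     : Carrier → Carrier → Set ℓ₁
    _≤_     : Carrier → Carrier → Set ℓ₂
    _ᗮ      : Carrier → Carrier

⌊_⌋ : ∀ {c ℓ₁ ℓ₂} → OrthomodularLattice c ℓ₁ ℓ₂ → Ortho c ℓ₁ ℓ₂
⌊ X ⌋ = record
  { Carrier = X.Carrier ; _≈_ = X._≈_ ; _≤_ = X._≤_ ; _ᗮ = X._ᗮ }
  where module X = OrthomodularLattice X

↓_[_] : ∀ {c ℓ₁ ℓ₂} (X : OrthomodularLattice c ℓ₁ ℓ₂) →
        OrthomodularLattice.Carrier X → Ortho (c ⊔ ℓ₂) ℓ₁ ℓ₂
↓ X [ k ] = record
  { Carrier = Σ[ u ∈ Carrier ] (u ≤ k)
  ; _≈_ = λ u v → proj₁ u ≈ proj₁ v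
  ; _≤_ = λ u v → proj₁ u ≤ proj₁ v
  ; _ᗮ = λ u → (k ∧ (proj₁ u) ᗮ) , proj₁ (infimum k ((proj₁ u) ᗮ))
  }
  where open OrthomodularLattice X

record Pair {a b ℓa ℓb ℓa' ℓb'} (A : Ortho a ℓa ℓa') (B : Ortho b ℓb ℓb')
       : Set (a ⊔ b) where
  constructor ⟨_,_⟩
  field
    lower : Ortho.Carrier A → Ortho.Carrier B   -- f_*
    upper : Ortho.Carrier B → Ortho.Carrier A   -- f^*
open Pair public

record IsMorphism {a b ℓa ℓb ℓa' ℓb'} {A : Ortho a ℓa ℓa'} {B : Ortho b ℓb ℓb'}
       (f : Pair A B) : Set (a ⊔ b ⊔ ℓa' ⊔ ℓb') where
  module A = Ortho A
  module B = Ortho B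
  field
    lower-antitone : ∀ {x x'} → x A.≤ x' → lower f x' B.≤ lower f x
    upper-antitone : ∀ {y y'} → y B.≤ y' → upper f y' A.≤ upper f y
    galois-⇒ : ∀ x y → x A.≤ upper f y → y B.≤ lower f x
    galois-⇐ : ∀ x y → y B.≤ lower f x → x A.≤ upper f y

idP : ∀ {a ℓ ℓ'} (A : Ortho a ℓ ℓ') → Pair A A
idP A = ⟨ Ortho._ᗮ A , Ortho._ᗮ A ⟩

infixr 9 _∘P_
_∘P_ : ∀ {a b c ℓa ℓb ℓc ℓa' ℓb' ℓc'}
         {A : Ortho a ℓa ℓa'} {B : Ortho b ℓb ℓb'} {C : Ortho c ℓc ℓc'} →
       Pair B C → Pair A B → Pair A C
_∘P_ {B = B} g f =
  ⟨ (λ x → lower g (Ortho._ᗮ B (lower f x)))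
  , (λ z → upper f (Ortho._ᗮ B (upper g z))) ⟩

infix 10 _†
_† : ∀ {a b ℓa ℓb ℓa' ℓb'} {A : Ortho a ℓa ℓa'} {B : Ortho b ℓb ℓb'} →
     Pair A B → Pair B A
⟨ l , u ⟩ † = ⟨ u , l ⟩

_≃_ : ∀ {a ℓ ℓ'} {A : Ortho a ℓ ℓ'} → Pair A A → Pair A A → Set (a ⊔ ℓ)
_≃_ {A = A} f g =
  (∀ x → lower f x ≈ lower g x) × (∀ x → upper f x ≈ upper g x)
  where open Ortho A

module _ {c ℓ₁ ℓ₂} (X : OrthomodularLattice c ℓ₁ ℓ₂) where
  open OrthomodularLattice X

  kerObj : Pair ⌊ X ⌋ ⌊ X ⌋ → Ortho (c ⊔ ℓ₂) ℓ₁ ℓ₂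
  kerObj s = ↓ X [ upper s ⊤ ]

  ker : (s : Pair ⌊ X ⌋ ⌊ X ⌋) → Pair (kerObj s) ⌊ X ⌋
  ker s = ⟨ (λ u → proj₁ u ᗮ)
          , (λ x → (upper s ⊤ ∧ x ᗮ) , proj₁ (infimum (upper s ⊤) (x ᗮ))) ⟩

  bracket : Pair ⌊ X ⌋ ⌊ X ⌋ → Pair ⌊ X ⌋ ⌊ X ⌋
  bracket s = ker s ∘P (ker s †)

-- Since End(X) is carved out of raw pairs by the
-- morphism condition M, and equality of morphisms is pointwise equality
-- (a setoid), the structure is stated relative to a predicate M and an
-- equality _≈_: M is closed under the operations, the operations respect
-- _≈_, and all axioms hold for elements of M (with "∃ y" ranging over M).

record IsFoulisSemigroup {a p ℓ} {S : Set a} (M : S → Set p)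
       (_≈_ : S → S → Set ℓ) (_·_ : S → S → S) (1# : S)
       (_ᵈ : S → S) ([_] : S → S) : Set (a ⊔ p ⊔ ℓ) where
  0# : S
  0# = [ 1# ]
  field
    M-1     : M 1#
    M-·     : ∀ {s t} → M s → M t → M (s · t)
    M-ᵈ     : ∀ {s} → M s → M (s ᵈ)
    M-[]    : ∀ {s} → M s → M [ s ]
    ≈-refl  : ∀ {s} → M s → s ≈ s
    ≈-sym   : ∀ {s t} → M s → M t → s ≈ t → t ≈ s
    ≈-trans : ∀ {s t u} → M s → M t → M u → s ≈ t → t ≈ u → s ≈ u
    ·-cong  : ∀ {s s' t t'} → M s → M s' → M t → M t' →
              s ≈ s' → t ≈ t' → (s · t) ≈ (s' · t')
    ᵈ-cong  : ∀ {s t} → M s → M t → s ≈ t → (s ᵈ) ≈ (t ᵈ)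
    []-cong : ∀ {s t} → M s → M t → s ≈ t → [ s ] ≈ [ t ]
    assoc     : ∀ {s t u} → M s → M t → M u → ((s · t) · u) ≈ (s · (t · u))
    identityˡ : ∀ {s} → M s → (1# · s) ≈ s
    identityʳ : ∀ {s} → M s → (s · 1#) ≈ s
    ᵈ-1       : (1# ᵈ) ≈ 1#
    ᵈ-·       : ∀ {s t} → M s → M t → ((s · t) ᵈ) ≈ ((t ᵈ) · (s ᵈ))
    ᵈ-ᵈ       : ∀ {s} → M s → ((s ᵈ) ᵈ) ≈ s
    []-idem   : ∀ {s} → M s → ([ s ] · [ s ]) ≈ [ s ]
    []-self   : ∀ {s} → M s → ([ s ] ᵈ) ≈ [ s ]
    zeroˡ     : ∀ {s} → M s → (0# · s) ≈ 0#
    zeroʳ     : ∀ {s} → M s → (s · 0#) ≈ 0#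
    foulis-⇒  : ∀ {s x} → M s → M x → (s · x) ≈ 0# →
                Σ[ y ∈ S ] (M y × (x ≈ ([ s ] · y)))
    foulis-⇐  : ∀ {s x y} → M s → M x → M y → x ≈ ([ s ] · y) →
                (s · x) ≈ 0#

module Submission where

-- The whole argument rests on one computation: for an endomorphism s with
-- kernel element k = s^*(1), both components of [s] = ker(s) ∘ ker(s)† are,
-- definitionally, x ↦ (k ∧ (k ∧ xᗮ)ᗮ)ᗮ, the orthocomplement of the Sasaki
-- projection x ↦ x & k onto k.

open import Defs
open import Data.Product using (_×_; _,_)
import Relation.Binary.Lattice.Properties.MeetSemilattice as MeetSemilatticeProperties
import Relation.Binary.Reasoning.PartialOrder as PosetReasoning

module OrthomodularFacts {c ℓ₁ ℓ₂} (X : OrthomodularLattice c ℓ₁ ℓ₂) where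
  open OrthomodularLattice X
  open MeetSemilatticeProperties meetSemilattice using (∧-cong; ∧-monotonic)
  open PosetReasoning poset

  ᗮᗮ-≤ : ∀ {x} → x ᗮ ᗮ ≤ x
  ᗮᗮ-≤ = reflexive (ᗮ-involutive _)

  ≤-ᗮᗮ : ∀ {x} → x ≤ x ᗮ ᗮ
  ≤-ᗮᗮ = reflexive (Eq.sym (ᗮ-involutive _))

  ᗮ-swapʳ : ∀ {x y} → x ≤ y ᗮ → y ≤ x ᗮ
  ᗮ-swapʳ p = trans ≤-ᗮᗮ (ᗮ-antitone p)

  ᗮ-swapˡ : ∀ {x y} → x ᗮ ≤ y → y ᗮ ≤ x
  ᗮ-swapˡ p = trans (ᗮ-antitone p) ᗮᗮ-≤

  ᗮ-cong : ∀ {x y} → x ≈ y → x ᗮ ≈ y ᗮ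
  ᗮ-cong e = antisym (ᗮ-antitone (reflexive (Eq.sym e))) (ᗮ-antitone (reflexive e))

  ⊤ᗮ-least : ∀ {y} → ⊤ ᗮ ≤ y
  ⊤ᗮ-least {y} = begin
    ⊤ ᗮ            ≤⟨ ∧-greatest refl (trans (maximum _) ≤-ᗮᗮ) ⟩
    ⊤ ᗮ ∧ ⊤ ᗮ ᗮ    ≈⟨ ᗮ-meet (⊤ ᗮ) ⟩
    ⊥              ≤⟨ minimum y ⟩
    y              ∎

  above-⊤-unique : ∀ {a b} → ⊤ ≤ a → ⊤ ≤ b → a ≈ b
  above-⊤-unique ha hb = antisym (trans (maximum _) hb) (trans (maximum _) ha)

  de-morgan : ∀ a b → (a ∧ b ᗮ) ᗮ ≈ a ᗮ ∨ b
  de-morgan a b = antisym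
    (ᗮ-swapˡ (∧-greatest (ᗮ-swapˡ (x≤x∨y _ _)) (ᗮ-antitone (y≤x∨y _ _))))
    (∨-least (ᗮ-antitone (x∧y≤x _ _)) (ᗮ-swapʳ (x∧y≤y _ _)))

  -- The Sasaki projection of x onto k, in the form in which it arises from
  -- the kernel of a morphism; it equals x & k (sasaki-≈-&).
  sasaki : Carrier → Carrier → Carrier
  sasaki k x = k ∧ (k ∧ x ᗮ) ᗮ

  sasaki-≤ : ∀ {k x} → sasaki k x ≤ k
  sasaki-≤ = x∧y≤x _ _

  -- The projection fixes ↓k; this is exactly the orthomodular law, applied
  -- to kᗮ ≤ aᗮ.
  sasaki-fix : ∀ {k a} → a ≤ k → sasaki k a ≈ a
  sasaki-fix {k} {a} a≤k = antisym
    (trans (ᗮ-swapʳ aᗮ≤sasakiᗮ) ᗮᗮ-≤)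
    (∧-greatest a≤k (ᗮ-swapʳ (x∧y≤y _ _)))
    where
    aᗮ≤sasakiᗮ : a ᗮ ≤ sasaki k a ᗮ
    aᗮ≤sasakiᗮ = begin
      a ᗮ                  ≈⟨ orthomodular (ᗮ-antitone a≤k) ⟩
      k ᗮ ∨ (k ᗮ ᗮ ∧ a ᗮ)  ≤⟨ ∨-least (ᗮ-antitone sasaki-≤)
                                (trans (∧-monotonic ᗮᗮ-≤ refl)
                                       (ᗮ-swapʳ (x∧y≤y _ _))) ⟩
      sasaki k a ᗮ         ∎

  sasaki-mono : ∀ {k x y} → x ≤ y → sasaki k x ≤ sasaki k y
  sasaki-mono x≤y = ∧-monotonic refl (ᗮ-antitone (∧-monotonic refl (ᗮ-antitone x≤y)))

  sasaki-adjoint : ∀ {k x y} → sasaki k y ≤ x ᗮ → sasaki k x ≤ y ᗮ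
  sasaki-adjoint {k} {x} {y} h = begin
    sasaki k x          ≤⟨ ∧-monotonic refl (ᗮ-antitone (∧-greatest sasaki-≤ h)) ⟩
    sasaki k (k ∧ y ᗮ)  ≈⟨ sasaki-fix (x∧y≤x _ _) ⟩
    k ∧ y ᗮ             ≤⟨ x∧y≤y _ _ ⟩
    y ᗮ                 ∎

  -- Idempotence, in the form [s]·[s] = [s] needs (composition inserts ᗮ).
  sasaki-idempotent : ∀ {k x} → sasaki k (sasaki k x ᗮ ᗮ) ≈ sasaki k x
  sasaki-idempotent = Eq.trans (sasaki-fix (trans ᗮᗮ-≤ sasaki-≤)) (ᗮ-involutive _)

  sasaki-congᵏ : ∀ {k k' x} → k ≈ k' → sasaki k x ≈ sasaki k' x
  sasaki-congᵏ e = ∧-cong e (ᗮ-cong (∧-cong e Eq.refl))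

  sasaki-≈-& : ∀ k x → sasaki k x ≈ x & k
  sasaki-≈-& k x = ∧-cong Eq.refl (de-morgan k x)

  sasakiᗮ-≈-⊃ : ∀ k x → sasaki k x ᗮ ≈ (k ⊃ x ᗮ)
  sasakiᗮ-≈-⊃ k x = de-morgan k (k ∧ x ᗮ)

module GaloisPair {a b ℓa ℓb ℓa' ℓb'}
    {X : OrthomodularLattice a ℓa ℓa'} {Y : OrthomodularLattice b ℓb ℓb'}
    {f : Pair ⌊ X ⌋ ⌊ Y ⌋} (m : IsMorphism f) where
  private
    module X = OrthomodularLattice X
    module Y = OrthomodularLattice Y
  open IsMorphism m using (lower-antitone; galois-⇒; galois-⇐)

  lower-cong : ∀ {x x'} → x X.≈ x' → lower f x Y.≈ lower f x'
  lower-cong e = Y.antisym (lower-antitone (X.reflexive (X.Eq.sym e)))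
                           (lower-antitone (X.reflexive e))

  upper-unique : {g : Pair ⌊ X ⌋ ⌊ Y ⌋} → IsMorphism g →
                 (∀ x → lower f x Y.≈ lower g x) → ∀ y → upper f y X.≈ upper g y
  upper-unique {g} mg e y = X.antisym
    (G.galois-⇐ _ y (Y.trans (galois-⇒ _ y X.refl) (Y.reflexive (e _))))
    (galois-⇐ _ y (Y.trans (G.galois-⇒ _ y X.refl) (Y.reflexive (Y.Eq.sym (e _)))))
    where module G = IsMorphism mg

id-morphism : ∀ {c ℓ₁ ℓ₂} {X : OrthomodularLattice c ℓ₁ ℓ₂} →
              IsMorphism (idP ⌊ X ⌋)
id-morphism {X = X} = record
  { lower-antitone = ᗮ-antitone ; upper-antitone = ᗮ-antitone
  ; galois-⇒ = λ _ _ → ᗮ-swapʳ ; galois-⇐ = λ _ _ → ᗮ-swapʳ }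
  where
  open OrthomodularLattice X using (ᗮ-antitone)
  open OrthomodularFacts X using (ᗮ-swapʳ)

-- Composition needs only contraposition in the middle lattice.
∘-morphism : ∀ {a b c ℓa ℓb ℓc ℓa' ℓb' ℓc'} {X : OrthomodularLattice a ℓa ℓa'}
  {Y : OrthomodularLattice b ℓb ℓb'} {Z : OrthomodularLattice c ℓc ℓc'}
  {g : Pair ⌊ Y ⌋ ⌊ Z ⌋} {f : Pair ⌊ X ⌋ ⌊ Y ⌋} →
  IsMorphism g → IsMorphism f → IsMorphism (g ∘P f)
∘-morphism {Y = Y} mg mf = record
  { lower-antitone = λ p → G.lower-antitone (ᗮ-antitone (F.lower-antitone p))
  ; upper-antitone = λ p → F.upper-antitone (ᗮ-antitone (G.upper-antitone p))
  ; galois-⇒ = λ x z h → G.galois-⇒ _ z (ᗮ-swapˡ (F.galois-⇒ x _ h))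
  ; galois-⇐ = λ x z h → F.galois-⇐ x _ (ᗮ-swapˡ (G.galois-⇐ _ z h)) }
  where
  module G = IsMorphism mg
  module F = IsMorphism mf
  open OrthomodularLattice Y using (ᗮ-antitone)
  open OrthomodularFacts Y using (ᗮ-swapˡ)

†-morphism : ∀ {a b ℓa ℓb ℓa' ℓb'} {A : Ortho a ℓa ℓa'} {B : Ortho b ℓb ℓb'}
  {f : Pair A B} → IsMorphism f → IsMorphism (f †)
†-morphism m = record
  { lower-antitone = upper-antitone ; upper-antitone = lower-antitone
  ; galois-⇒ = λ x y h → galois-⇐ y x h ; galois-⇐ = λ x y h → galois-⇒ y x h }
  where open IsMorphism m

module Endomorphisms {c ℓ₁ ℓ₂} (X : OrthomodularLattice c ℓ₁ ℓ₂) where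
  open OrthomodularLattice X
  open OrthomodularFacts X

  End : Set c
  End = Pair ⌊ X ⌋ ⌊ X ⌋

  module EndMorphism {f : End} (m : IsMorphism f) = GaloisPair {X = X} {Y = X} m

  id-closed : IsMorphism (idP ⌊ X ⌋)
  id-closed = id-morphism {X = X}

  ∘-closed : ∀ {g f : End} → IsMorphism g → IsMorphism f → IsMorphism (g ∘P f)
  ∘-closed = ∘-morphism {X = X} {Y = X} {Z = X}

  -- Unfolding
  -- the kernel, bracket X s is definitionally sasakiPair (upper s ⊤); this
  -- is how all facts about sasakiPair below apply to [s].
  sasakiPair : Carrier → End
  sasakiPair k = ⟨ (λ x → sasaki k x ᗮ) , (λ x → sasaki k x ᗮ) ⟩

  -- The zero [id] = [1]: its kernel element is ⊤ᗮ = ⊥.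
  0# : End
  0# = bracket X (idP ⌊ X ⌋)

  sasakiPair-morphism : ∀ {k} → IsMorphism (sasakiPair k)
  sasakiPair-morphism = record
    { lower-antitone = λ p → ᗮ-antitone (sasaki-mono p)
    ; upper-antitone = λ p → ᗮ-antitone (sasaki-mono p)
    ; galois-⇒ = λ _ _ h → ᗮ-swapʳ (sasaki-adjoint (ᗮ-swapʳ h))
    ; galois-⇐ = λ _ _ h → ᗮ-swapʳ (sasaki-adjoint (ᗮ-swapʳ h)) }

  ≃-refl : ∀ {f : End} → f ≃ f
  ≃-refl = (λ _ → Eq.refl) , (λ _ → Eq.refl)

  ≃-sym : ∀ {f g : End} → f ≃ g → g ≃ f
  ≃-sym (el , eu) = (λ x → Eq.sym (el x)) , (λ x → Eq.sym (eu x))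

  ≃-trans : ∀ {f g h : End} → f ≃ g → g ≃ h → f ≃ h
  ≃-trans (el , eu) (el' , eu') =
    (λ x → Eq.trans (el x) (el' x)) , (λ x → Eq.trans (eu x) (eu' x))

  ≃-by-lower : ∀ {f g : End} → IsMorphism f → IsMorphism g →
               (∀ x → lower f x ≈ lower g x) → f ≃ g
  ≃-by-lower mf mg e = e , EndMorphism.upper-unique mf mg e

  ∘-cong : ∀ {s s' t t' : End} →
           IsMorphism s → IsMorphism s' → IsMorphism t → IsMorphism t' →
           s ≃ s' → t ≃ t' → (s ∘P t) ≃ (s' ∘P t')
  ∘-cong ms ms' mt mt' (es , _) (et , _) =
    ≃-by-lower (∘-closed ms mt) (∘-closed ms' mt')
      (λ x → Eq.trans (EndMorphism.lower-cong ms (ᗮ-cong (et x))) (es _))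

  identityˡ : ∀ {s : End} → IsMorphism s → (idP ⌊ X ⌋ ∘P s) ≃ s
  identityˡ ms = ≃-by-lower (∘-closed id-closed ms) ms (λ _ → ᗮ-involutive _)

  identityʳ : ∀ {s : End} → IsMorphism s → (s ∘P idP ⌊ X ⌋) ≃ s
  identityʳ ms = ≃-by-lower (∘-closed ms id-closed) ms
                   (λ _ → EndMorphism.lower-cong ms (ᗮ-involutive _))

  sasakiPair-cong : ∀ {k k'} → k ≈ k' → sasakiPair k ≃ sasakiPair k'
  sasakiPair-cong e =
    (λ _ → ᗮ-cong (sasaki-congᵏ e)) , (λ _ → ᗮ-cong (sasaki-congᵏ e))

  sasakiPair-idempotent : ∀ {k} → (sasakiPair k ∘P sasakiPair k) ≃ sasakiPair k
  sasakiPair-idempotent =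
    (λ _ → ᗮ-cong sasaki-idempotent) , (λ _ → ᗮ-cong sasaki-idempotent)

  zero-top : ∀ x → ⊤ ≤ lower 0# x
  zero-top _ = ᗮ-swapʳ sasaki-≤

  ≃-zero : ∀ {f : End} → IsMorphism f → (∀ x → ⊤ ≤ lower f x) → f ≃ 0#
  ≃-zero mf top = ≃-by-lower mf sasakiPair-morphism
                    (λ x → above-⊤-unique (top x) (zero-top x))

  zeroˡ : ∀ {s : End} → IsMorphism s → (0# ∘P s) ≃ 0#
  zeroˡ ms = ≃-zero (∘-closed sasakiPair-morphism ms) (λ _ → zero-top _)

  -- s ∘ x = 0 exactly when the range of x lies below the kernel element
  -- s^*(1); this is the Galois condition at ⊤.
  annihilated⇒range-in-kernel : ∀ {s x : End} → IsMorphism s → (s ∘P x) ≃ 0# →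
                                ∀ x' → lower x x' ᗮ ≤ upper s ⊤
  annihilated⇒range-in-kernel ms (e , _) x' =
    IsMorphism.galois-⇐ ms _ ⊤ (trans (zero-top x') (reflexive (Eq.sym (e x'))))

  range-in-kernel⇒annihilated : ∀ {s x : End} → IsMorphism s → IsMorphism x →
                                (∀ x' → lower x x' ᗮ ≤ upper s ⊤) → (s ∘P x) ≃ 0#
  range-in-kernel⇒annihilated ms mx r =
    ≃-zero (∘-closed ms mx) (λ x' → IsMorphism.galois-⇒ ms _ ⊤ (r x'))

  zeroʳ : ∀ {s : End} → IsMorphism s → (s ∘P 0#) ≃ 0#
  zeroʳ ms = range-in-kernel⇒annihilated ms sasakiPair-morphism
               (λ _ → trans ᗮᗮ-≤ (trans sasaki-≤ ⊤ᗮ-least))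

  projection-absorbs : ∀ {k} {x : End} → IsMorphism x →
                       (∀ x' → lower x x' ᗮ ≤ k) → x ≃ (sasakiPair k ∘P x)
  projection-absorbs mx r = ≃-by-lower mx (∘-closed sasakiPair-morphism mx)
    (λ x' → Eq.sym (Eq.trans (ᗮ-cong (sasaki-fix (r x'))) (ᗮ-involutive _)))

  projection-range : ∀ {k} {x y : End} → x ≃ (sasakiPair k ∘P y) →
                     ∀ x' → lower x x' ᗮ ≤ k
  projection-range (e , _) x' =
    trans (ᗮ-antitone (reflexive (Eq.sym (e x')))) (trans ᗮᗮ-≤ sasaki-≤)

  End-isFoulisSemigroup :
    IsFoulisSemigroup {S = End} IsMorphism _≃_ _∘P_ (idP ⌊ X ⌋) _† (bracket X)
  End-isFoulisSemigroup = record
    { M-1 = id-closed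
    ; M-· = ∘-closed
    ; M-ᵈ = †-morphism
    ; M-[] = λ _ → sasakiPair-morphism
    ; ≈-refl = λ _ → ≃-refl
    ; ≈-sym = λ _ _ → ≃-sym
    ; ≈-trans = λ _ _ _ → ≃-trans
    ; ·-cong = ∘-cong
    ; ᵈ-cong = λ _ _ (el , eu) → eu , el
    ; []-cong = λ _ _ (_ , eu) → sasakiPair-cong (eu ⊤)
    ; assoc = λ _ _ _ → ≃-refl
    ; identityˡ = identityˡ
    ; identityʳ = identityʳ
    ; ᵈ-1 = ≃-refl
    ; ᵈ-· = λ _ _ → ≃-refl
    ; ᵈ-ᵈ = λ _ → ≃-refl
    ; []-idem = λ _ → sasakiPair-idempotent
    ; []-self = λ _ → ≃-refl
    ; zeroˡ = zeroˡ
    ; zeroʳ = zeroʳ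
    ; foulis-⇒ = λ {_} {x} ms mx h →
        x , mx , projection-absorbs mx (annihilated⇒range-in-kernel {x = x} ms h)
    ; foulis-⇐ = λ {_} {x} {y} ms mx _ h →
        range-in-kernel⇒annihilated ms mx (projection-range {x = x} {y = y} h)
    }

  bracket-formula : ∀ (s : End) x →
      (lower (bracket X s) x ≈ upper (bracket X s) x)
    × (upper (bracket X s) x ≈ (upper s ⊤ ⊃ x ᗮ))
    × ((upper s ⊤ ⊃ x ᗮ) ≈ ((upper s ⊤) ᗮ ∨ (upper s ⊤ ∧ x ᗮ)))
    × (((upper s ⊤) ᗮ ∨ (upper s ⊤ ∧ x ᗮ)) ≈ ((x & upper s ⊤) ᗮ))
  bracket-formula s x =
      Eq.refl
    , sasakiᗮ-≈-⊃ k x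
    , Eq.refl
    , Eq.trans (Eq.sym (sasakiᗮ-≈-⊃ k x)) (ᗮ-cong (sasaki-≈-& k x))
    where k = upper s ⊤

corollary4p3 : ∀ {c ℓ₁ ℓ₂} (X : OrthomodularLattice c ℓ₁ ℓ₂) →
    IsFoulisSemigroup {S = Pair ⌊ X ⌋ ⌊ X ⌋} IsMorphism _≃_ _∘P_ (idP ⌊ X ⌋) _† (bracket X)
    × (∀ (s : Pair ⌊ X ⌋ ⌊ X ⌋) → IsMorphism s → ∀ x →
         let open OrthomodularLattice X in
         (lower (bracket X s) x ≈ upper (bracket X s) x)
         × (upper (bracket X s) x ≈ (upper s ⊤ ⊃ x ᗮ))
         × ((upper s ⊤ ⊃ x ᗮ) ≈ ((upper s ⊤) ᗮ ∨ (upper s ⊤ ∧ x ᗮ)))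
         × (((upper s ⊤) ᗮ ∨ (upper s ⊤ ∧ x ᗮ)) ≈ ((x & upper s ⊤) ᗮ)))
corollary4p3 X = End-isFoulisSemigroup , λ s _ → bracket-formula s
  where open Endomorphisms X
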